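{- Let $G$ be a connected graph with $n$ vertices, $m$ edges, maximum degree $\Delta$ and cyclomatic number $c=m-n+1$ satisfying $1\le c\le \frac{n+2}{2}$. Then $$S(G)=\frac2n\sum_{i=3}^{\Delta}N_i(in-2m),\qquad \mathrm{Var}(G)=\frac1n\sum_{i=3}^{\Delta}N_i(i-1)(i-2)-\frac{2(2m-n)(m-n)}{n^2}.$$
   Context: $N_i$ is the number of vertices of degree $i$. With degrees $d_1,\dots,d_n$: $S(G)=\sum_i|d_i-\frac{2m}{n}|$, $\mathrm{Var}(G)=\frac1n\sum_i(d_i-\frac{2m}{n})^2$. -}

module Defs where

open import Data.Bool using (Bool; true; false; if_then_else_)
open import Data.Nat as ℕ using (ℕ; zero; suc; _⊔_; NonZero)
open import Data.Nat using (_≟_)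
open import Data.Fin using (Fin; toℕ)
open import Data.List using (List; map; allFin; upTo; drop; foldr)
open import Data.Nat.ListAction using (sum)
open import Data.Integer using (+_)
open import Data.Rational using (ℚ; _+_; _*_; _-_; ∣_∣; _/_)
open import Relation.Binary.PropositionalEquality using (_≡_)
open import Relation.Nullary.Decidable using (⌊_⌋)

record Graph (n : ℕ) : Set where
  field
    adj    : Fin n → Fin n → Bool
    adj-sym    : ∀ i j → adj i j ≡ adj j i
    adj-irrefl : ∀ i → adj i i ≡ false
open Graph public

⟦_⟧ : ℕ → ℚ
⟦ k ⟧ = (+ k) / 1

[_] : Bool → ℕ
[ b ] = if b then 1 else 0

module _ {n : ℕ} (G : Graph n) where

  deg : Fin n → ℕ
  deg v = sum (map (λ w → [ adj G v w ]) (allFin n))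

  edges : ℕ
  edges = sum (map (λ i → sum (map (λ j →
            [ ⌊ toℕ i ℕ.<? toℕ j ⌋ ]  ℕ.* [ adj G i j ]) (allFin n))) (allFin n))

  -- maximum degree Δ (0 for the empty graph)
  maxDeg : ℕ
  maxDeg = foldr _⊔_ 0 (map deg (allFin n))

  N : ℕ → ℕ
  N i = sum (map (λ v → [ ⌊ deg v ≟ i ⌋ ]) (allFin n))

  data Reach : Fin n → Fin n → Set where
    here : ∀ {u} → Reach u u
    step : ∀ {u w v} → adj G u w ≡ true → Reach w v → Reach u v

  Connected : Set
  Connected = ∀ u v → Reach u v

  -- cyclomatic number c = m - n + 1 (as a rational, may be negative a priori)
  cyclomatic : ℚ
  cyclomatic = ⟦ edges ⟧ - ⟦ n ⟧ + ⟦ 1 ⟧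

  module _ .{{_ : NonZero n}} where
    avgDeg : ℚ
    avgDeg = (+ (2 ℕ.* edges)) / n

    S : ℚ
    S = foldr _+_ ⟦ 0 ⟧ (map (λ v → ∣ ⟦ deg v ⟧ - avgDeg ∣) (allFin n))

    Var : ℚ
    Var = ((+ 1) / n) * foldr _+_ ⟦ 0 ⟧
            (map (λ v → (⟦ deg v ⟧ - avgDeg) * (⟦ deg v ⟧ - avgDeg)) (allFin n))

-- Σ_{i=a}^{b} f i  (empty when b < a)
sumFromTo : ℕ → ℕ → (ℕ → ℚ) → ℚ
sumFromTo a b f = foldr _+_ ⟦ 0 ⟧ (map f (drop a (upTo (suc b))))

{-# OPTIONS --safe #-}
-- The hypotheses 1 ≤ c ≤ (n + 2)/2 say n ≤ m ≤ 3n/2, i.e. the average degree a = 2m/n lies in [2, 3].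
-- Hence d − a ≥ 0 exactly when d ≥ 3 and d − a ≤ 0 otherwise, so |d − a| = 2[d ≥ 3](d − a) − (d − a);
-- since Σᵥ (dᵥ − a) = 0 by the handshake lemma, S(G) = 2 Σ_{dᵥ ≥ 3} (dᵥ − a), and grouping the vertices
-- by degree gives the first formula. For the variance expand (d − a)² = (d − 1)(d − 2) + (3 − 2a)d + a² − 2:
-- a connected graph with m ≥ n ≥ 1 has n ≥ 2, so every degree is ≥ 1 and (dᵥ − 1)(dᵥ − 2) vanishes unless
-- dᵥ ≥ 3, while the remaining terms sum to (3 − 2a)·2m + n(a² − 2) = −2(2m − n)(m − n)/n.
module Submission where

open import Defs
open import Data.Nat using (ℕ; NonZero)
open import Data.Nat as ℕ using ()
open import Data.Integer using (+_)
open import Data.Rational using (ℚ; _≤_; _*_; _-_; _/_)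
open import Data.Product using (_×_)
open import Relation.Binary.PropositionalEquality using (_≡_)

open import Level using (0ℓ)
open import Algebra.Bundles using (CommutativeMonoid)
import Algebra.Properties.CommutativeSemigroup as CommutativeSemigroupProperties
open import Data.Bool using (true)
open import Data.Nat using (zero; suc; z≤n; s≤s)
import Data.Nat.Properties as ℕₚ
import Data.Integer as ℤ
import Data.Integer.Properties as ℤₚ
open import Data.Rational using (mkℚ; *≤*; _+_; -_; 0ℚ; 1ℚ; ∣_∣)
open import Data.Rational.Properties
import Data.Nat.Coprimality as Coprimality
open import Data.Fin as Fin using (Fin; toℕ; punchIn)
open import Data.Fin.Properties using (toℕ-injective; punchInᵢ≢i)
open import Data.List using (List; []; _∷_; map; foldr; allFin; upTo; drop; _++_; length)
open import Data.List.Properties using (upTo-∷ʳ; length-tabulate)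
open import Data.List.Relation.Unary.Any using (here; there)
open import Data.List.Membership.Propositional using (_∈_)
open import Data.List.Membership.Propositional.Properties using (∈-allFin; ∈-map⁺)
open import Data.Product using (_,_)
open import Function using (_∘_)
open import Relation.Binary.Definitions using (Tri; tri<; tri≈; tri>)
open import Relation.Binary.PropositionalEquality
  using (refl; sym; trans; cong; cong₂; subst; subst₂; module ≡-Reasoning)
open import Relation.Nullary using (Dec; yes; no; ¬_)
open import Relation.Nullary.Decidable using (⌊_⌋)
open import Data.Empty using (⊥-elim)
open import Data.Rational.Solver using (module +-*-Solver)
open +-*-Solver using (solve; _:+_; _:*_; _:-_; :-_; _:=_; con)
open CommutativeSemigroupProperties (CommutativeMonoid.commutativeSemigroup *-1-commutativeMonoid)
  using (x∙yz≈y∙xz)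

⟦⟧≡mkℚ : ∀ k → ⟦ k ⟧ ≡ mkℚ (+ k) 0 (Coprimality.sym (Coprimality.1-coprimeTo k))
⟦⟧≡mkℚ k = ↥p/↧p≡p _

⟦⟧-homo-+ : ∀ a b → ⟦ a ℕ.+ b ⟧ ≡ ⟦ a ⟧ + ⟦ b ⟧
⟦⟧-homo-+ a b rewrite ⟦⟧≡mkℚ a | ⟦⟧≡mkℚ b =
  /-cong (cong₂ ℤ._+_ (sym (ℤₚ.*-identityʳ (+ a))) (sym (ℤₚ.*-identityʳ (+ b)))) refl

⟦⟧-homo-* : ∀ a b → ⟦ a ℕ.* b ⟧ ≡ ⟦ a ⟧ * ⟦ b ⟧
⟦⟧-homo-* a b rewrite ⟦⟧≡mkℚ a | ⟦⟧≡mkℚ b = /-cong (ℤₚ.pos-* a b) refl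

⟦⟧-mono-≤ : ∀ {a b} → a ℕ.≤ b → ⟦ a ⟧ ≤ ⟦ b ⟧
⟦⟧-mono-≤ {a} {b} a≤b rewrite ⟦⟧≡mkℚ a | ⟦⟧≡mkℚ b =
  *≤* (subst₂ ℤ._≤_ (sym (ℤₚ.*-identityʳ (+ a))) (sym (ℤₚ.*-identityʳ (+ b))) (ℤ.+≤+ a≤b))

⟦⟧-cancel-≤ : ∀ {a b} → ⟦ a ⟧ ≤ ⟦ b ⟧ → a ℕ.≤ b
⟦⟧-cancel-≤ {a} {b} le = ℤₚ.drop‿+≤+
  (subst₂ ℤ._≤_ (ℤₚ.*-identityʳ (+ a)) (ℤₚ.*-identityʳ (+ b))
    (drop-*≤* (subst₂ _≤_ (⟦⟧≡mkℚ a) (⟦⟧≡mkℚ b) le)))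

1/n≡mkℚ : ∀ n-1 → (+ 1) / suc n-1 ≡ mkℚ (+ 1) n-1 (Coprimality.1-coprimeTo (suc n-1))
1/n≡mkℚ n-1 = ↥p/↧p≡p _

k/n≡⟦k⟧*1/n : ∀ k n .{{_ : NonZero n}} → (+ k) / n ≡ ⟦ k ⟧ * ((+ 1) / n)
k/n≡⟦k⟧*1/n k (suc n-1) rewrite ⟦⟧≡mkℚ k | 1/n≡mkℚ n-1 =
  /-cong (sym (ℤₚ.*-identityʳ (+ k))) (sym (ℕₚ.+-identityʳ (suc n-1)))

⟦n⟧*1/n≡1 : ∀ n .{{_ : NonZero n}} → ⟦ n ⟧ * ((+ 1) / n) ≡ 1ℚ
⟦n⟧*1/n≡1 (suc n-1) rewrite ⟦⟧≡mkℚ (suc n-1) | 1/n≡mkℚ n-1 =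
  *-inverseʳ (mkℚ (+ suc n-1) 0 (Coprimality.sym (Coprimality.1-coprimeTo (suc n-1))))

⟦k⟧≡⟦k*n⟧*1/n : ∀ k n .{{_ : NonZero n}} → ⟦ k ⟧ ≡ ⟦ k ℕ.* n ⟧ * ((+ 1) / n)
⟦k⟧≡⟦k*n⟧*1/n k n = sym (begin
  ⟦ k ℕ.* n ⟧ * ((+ 1) / n)      ≡⟨ cong (_* ((+ 1) / n)) (⟦⟧-homo-* k n) ⟩
  ⟦ k ⟧ * ⟦ n ⟧ * ((+ 1) / n)    ≡⟨ *-assoc ⟦ k ⟧ ⟦ n ⟧ ((+ 1) / n) ⟩
  ⟦ k ⟧ * (⟦ n ⟧ * ((+ 1) / n))  ≡⟨ cong (⟦ k ⟧ *_) (⟦n⟧*1/n≡1 n) ⟩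
  ⟦ k ⟧ * 1ℚ                     ≡⟨ *-identityʳ ⟦ k ⟧ ⟩
  ⟦ k ⟧                          ∎)
  where open ≡-Reasoning

⟦n⟧*k/n≡⟦k⟧ : ∀ n .{{_ : NonZero n}} k → ⟦ n ⟧ * ((+ k) / n) ≡ ⟦ k ⟧
⟦n⟧*k/n≡⟦k⟧ n k = begin
  ⟦ n ⟧ * ((+ k) / n)            ≡⟨ cong (⟦ n ⟧ *_) (k/n≡⟦k⟧*1/n k n) ⟩
  ⟦ n ⟧ * (⟦ k ⟧ * ((+ 1) / n))  ≡⟨ x∙yz≈y∙xz ⟦ n ⟧ ⟦ k ⟧ ((+ 1) / n) ⟩
  ⟦ k ⟧ * (⟦ n ⟧ * ((+ 1) / n))  ≡⟨ cong (⟦ k ⟧ *_) (⟦n⟧*1/n≡1 n) ⟩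
  ⟦ k ⟧ * 1ℚ                     ≡⟨ *-identityʳ ⟦ k ⟧ ⟩
  ⟦ k ⟧                          ∎
  where open ≡-Reasoning

⟦⟧*1/n-mono-≤ : ∀ n .{{_ : NonZero n}} {a b} → a ℕ.≤ b → ⟦ a ⟧ * ((+ 1) / n) ≤ ⟦ b ⟧ * ((+ 1) / n)
⟦⟧*1/n-mono-≤ n a≤b = *-monoʳ-≤-nonNeg ((+ 1) / n) {{normalize-nonNeg 1 n}} (⟦⟧-mono-≤ a≤b)

0≤p-q : ∀ {p q} → q ≤ p → 0ℚ ≤ p - q
0≤p-q {p} {q} q≤p = subst (_≤ p - q) (+-inverseʳ q) (+-monoˡ-≤ (- q) q≤p)

∣p-q∣≡p-q : ∀ {p q} → q ≤ p → ∣ p - q ∣ ≡ p - q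
∣p-q∣≡p-q = 0≤p⇒∣p∣≡p ∘ 0≤p-q

∣p-q∣≡q-p : ∀ {p q} → p ≤ q → ∣ p - q ∣ ≡ q - p
∣p-q∣≡q-p {p} {q} p≤q = begin
  ∣ p - q ∣      ≡⟨ sym (∣-p∣≡∣p∣ (p - q)) ⟩
  ∣ - (p - q) ∣  ≡⟨ cong ∣_∣ (solve 2 (λ p q → :- (p :- q) := q :- p) refl p q) ⟩
  ∣ q - p ∣      ≡⟨ ∣p-q∣≡p-q p≤q ⟩
  q - p          ∎
  where open ≡-Reasoning

∣p-q∣-by-sign : ∀ {p q} {A : Set} (A? : Dec A) → (A → q ≤ p) → (¬ A → p ≤ q) →
  ∣ p - q ∣ ≡ ⟦ 2 ⟧ * (⟦ [ ⌊ A? ⌋ ] ⟧ * (p - q)) - (p - q)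
∣p-q∣-by-sign {p} {q} (yes a) q≤p _ = trans (∣p-q∣≡p-q (q≤p a))
  (solve 2 (λ p q → p :- q := con ⟦ 2 ⟧ :* (con ⟦ 1 ⟧ :* (p :- q)) :- (p :- q)) refl p q)
∣p-q∣-by-sign {p} {q} (no ¬a) _ p≤q = trans (∣p-q∣≡q-p (p≤q ¬a))
  (solve 2 (λ p q → q :- p := con ⟦ 2 ⟧ :* (con ⟦ 0 ⟧ :* (p :- q)) :- (p :- q)) refl p q)

shift-≤ : ∀ {p q p′ q′} t → p ≤ q → p + t ≡ p′ → q + t ≡ q′ → p′ ≤ q′
shift-≤ t p≤q refl refl = +-monoˡ-≤ t p≤q

square-expansion : ∀ d a → (d - a) * (d - a) ≡ (d - ⟦ 1 ⟧) * (d - ⟦ 2 ⟧) + ((⟦ 3 ⟧ - ⟦ 2 ⟧ * a) * d + (a * a - ⟦ 2 ⟧))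
square-expansion = solve 2 (λ d a → (d :- a) :* (d :- a) :=
  (d :- con ⟦ 1 ⟧) :* (d :- con ⟦ 2 ⟧) :+ ((con ⟦ 3 ⟧ :- con ⟦ 2 ⟧ :* a) :* d :+ (a :* a :- con ⟦ 2 ⟧))) refl

-- The ring solver cannot use N * x = 1, so identities that need it are proved up to an explicit multiple of 1 - N * x.
≡-modulo-inverse : ∀ {N x p q} W → N * x ≡ 1ℚ → p ≡ q + (1ℚ - N * x) * W → p ≡ q
≡-modulo-inverse {q = q} W Nx≡1 p≡q+ = trans p≡q+ (trans (cong (λ t → q + (1ℚ - t) * W) Nx≡1)
  (solve 2 (λ q W → q :+ (con 1ℚ :- con 1ℚ) :* W := q) refl q W))

variance-identity : ∀ T M N x → N * x ≡ 1ℚ →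
  x * (T + ((⟦ 3 ⟧ - ⟦ 2 ⟧ * (⟦ 2 ⟧ * M * x)) * (⟦ 2 ⟧ * M) + N * ((⟦ 2 ⟧ * M * x) * (⟦ 2 ⟧ * M * x) - ⟦ 2 ⟧)))
  ≡ x * T - ⟦ 2 ⟧ * x * x * ((⟦ 2 ⟧ * M - N) * (M - N))
variance-identity T M N x Nx≡1 = ≡-modulo-inverse {N} {x} (⟦ 6 ⟧ * M * x - ⟦ 4 ⟧ * M * M * x * x - ⟦ 2 ⟧ * N * x) Nx≡1
  (solve 4 (λ T M N x →
     x :* (T :+ ((con ⟦ 3 ⟧ :- con ⟦ 2 ⟧ :* (con ⟦ 2 ⟧ :* M :* x)) :* (con ⟦ 2 ⟧ :* M)
                 :+ N :* ((con ⟦ 2 ⟧ :* M :* x) :* (con ⟦ 2 ⟧ :* M :* x) :- con ⟦ 2 ⟧)))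
     := (x :* T :- con ⟦ 2 ⟧ :* x :* x :* ((con ⟦ 2 ⟧ :* M :- N) :* (M :- N)))
        :+ (con 1ℚ :- N :* x) :* (con ⟦ 6 ⟧ :* M :* x :- con ⟦ 4 ⟧ :* M :* M :* x :* x :- con ⟦ 2 ⟧ :* N :* x))
   refl T M N x)

module ListSum (M : CommutativeMonoid 0ℓ 0ℓ) where
  open CommutativeMonoid M
    using (_≈_; _∙_; ε; ∙-cong; ∙-congˡ; assoc; identityˡ; setoid; commutativeSemigroup)
    renaming (Carrier to A; refl to ≈-refl; sym to ≈-sym; trans to ≈-trans)
  open CommutativeSemigroupProperties commutativeSemigroup using (interchange)
  open import Relation.Binary.Reasoning.Setoid setoid

  Σ : {B : Set} → List B → (B → A) → A
  Σ xs f = foldr _∙_ ε (map f xs)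

  Σ-cong : ∀ {B : Set} (xs : List B) {f g : B → A} → (∀ b → f b ≈ g b) → Σ xs f ≈ Σ xs g
  Σ-cong []       f≈g = ≈-refl
  Σ-cong (x ∷ xs) f≈g = ∙-cong (f≈g x) (Σ-cong xs f≈g)

  Σ-ε : ∀ {B : Set} (xs : List B) → Σ xs (λ _ → ε) ≈ ε
  Σ-ε []       = ≈-refl
  Σ-ε (x ∷ xs) = ≈-trans (∙-congˡ (Σ-ε xs)) (identityˡ ε)

  Σ-++ : ∀ {B : Set} (xs ys : List B) (f : B → A) → Σ (xs ++ ys) f ≈ Σ xs f ∙ Σ ys f
  Σ-++ []       ys f = ≈-sym (identityˡ (Σ ys f))
  Σ-++ (x ∷ xs) ys f = ≈-trans (∙-congˡ (Σ-++ xs ys f)) (≈-sym (assoc (f x) (Σ xs f) (Σ ys f)))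

  Σ-∙ : ∀ {B : Set} (xs : List B) (f g : B → A) → Σ xs (λ b → f b ∙ g b) ≈ Σ xs f ∙ Σ xs g
  Σ-∙ []       f g = ≈-sym (identityˡ ε)
  Σ-∙ (x ∷ xs) f g = begin
    (f x ∙ g x) ∙ Σ xs (λ b → f b ∙ g b)  ≈⟨ ∙-congˡ (Σ-∙ xs f g) ⟩
    (f x ∙ g x) ∙ (Σ xs f ∙ Σ xs g)       ≈⟨ interchange (f x) (g x) (Σ xs f) (Σ xs g) ⟩
    (f x ∙ Σ xs f) ∙ (g x ∙ Σ xs g)       ∎

  Σ-swap : ∀ {B C : Set} (xs : List B) (ys : List C) (f : B → C → A) →
           Σ xs (λ b → Σ ys (f b)) ≈ Σ ys (λ c → Σ xs (λ b → f b c))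
  Σ-swap []       ys f = ≈-sym (Σ-ε ys)
  Σ-swap (x ∷ xs) ys f = begin
    Σ ys (f x) ∙ Σ xs (λ b → Σ ys (f b))          ≈⟨ ∙-congˡ (Σ-swap xs ys f) ⟩
    Σ ys (f x) ∙ Σ ys (λ c → Σ xs (λ b → f b c))  ≈⟨ ≈-sym (Σ-∙ ys (f x) (λ c → Σ xs (λ b → f b c))) ⟩
    Σ ys (λ c → f x c ∙ Σ xs (λ b → f b c))       ∎

module ℕSum = ListSum ℕₚ.+-0-commutativeMonoid
open ListSum +-0-commutativeMonoid

Σ-*ˡ : ∀ {B : Set} (xs : List B) (f : B → ℚ) r → Σ xs (λ b → r * f b) ≡ r * Σ xs f
Σ-*ˡ []       f r = sym (*-zeroʳ r)
Σ-*ˡ (x ∷ xs) f r = trans (cong (_+_ (r * f x)) (Σ-*ˡ xs f r)) (sym (*-distribˡ-+ r (f x) (Σ xs f)))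

Σ-*ʳ : ∀ {B : Set} (xs : List B) (f : B → ℚ) r → Σ xs (λ b → f b * r) ≡ Σ xs f * r
Σ-*ʳ xs f r = trans (Σ-cong xs (λ b → *-comm (f b) r)) (trans (Σ-*ˡ xs f r) (*-comm r (Σ xs f)))

Σ-- : ∀ {B : Set} (xs : List B) (f g : B → ℚ) → Σ xs (λ b → f b - g b) ≡ Σ xs f - Σ xs g
Σ-- []       f g = refl
Σ-- (x ∷ xs) f g = trans (cong (_+_ (f x - g x)) (Σ-- xs f g))
  (solve 4 (λ a b c d → (a :- b) :+ (c :- d) := (a :+ c) :- (b :+ d)) refl (f x) (g x) (Σ xs f) (Σ xs g))

Σ-const : ∀ {B : Set} (xs : List B) r → Σ xs (λ _ → r) ≡ ⟦ length xs ⟧ * r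
Σ-const []       r = sym (*-zeroˡ r)
Σ-const (x ∷ xs) r = begin
  r + Σ xs (λ _ → r)         ≡⟨ cong (_+_ r) (Σ-const xs r) ⟩
  r + ⟦ length xs ⟧ * r      ≡⟨ solve 2 (λ r l → r :+ l :* r := (con 1ℚ :+ l) :* r) refl r ⟦ length xs ⟧ ⟩
  (1ℚ + ⟦ length xs ⟧) * r   ≡⟨ cong (_* r) (sym (⟦⟧-homo-+ 1 (length xs))) ⟩
  ⟦ suc (length xs) ⟧ * r    ∎
  where open ≡-Reasoning

⟦⟧-Σ : ∀ {B : Set} (xs : List B) (f : B → ℕ) → ⟦ ℕSum.Σ xs f ⟧ ≡ Σ xs (⟦_⟧ ∘ f)
⟦⟧-Σ []       f = refl
⟦⟧-Σ (x ∷ xs) f = trans (⟦⟧-homo-+ (f x) (ℕSum.Σ xs f)) (cong (_+_ ⟦ f x ⟧) (⟦⟧-Σ xs f))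

∈⇒≤sum : ∀ {xs : List ℕ} {k} → k ∈ xs → k ℕ.≤ foldr ℕ._+_ 0 xs
∈⇒≤sum {x ∷ xs} (here refl) = ℕₚ.m≤m+n x _
∈⇒≤sum {x ∷ xs} (there k∈xs) = ℕₚ.≤-trans (∈⇒≤sum k∈xs) (ℕₚ.m≤n+m _ x)

∈⇒≤max : ∀ {xs : List ℕ} {k} → k ∈ xs → k ℕ.≤ foldr ℕ._⊔_ 0 xs
∈⇒≤max {x ∷ xs} (here refl) = ℕₚ.m≤m⊔n x _
∈⇒≤max {x ∷ xs} (there k∈xs) = ℕₚ.≤-trans (∈⇒≤max k∈xs) (ℕₚ.m≤n⊔m x _)

[⌊⌋]-yes : ∀ {P : Set} (P? : Dec P) → P → [ ⌊ P? ⌋ ] ≡ 1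
[⌊⌋]-yes (yes _) _  = refl
[⌊⌋]-yes (no ¬p) p = ⊥-elim (¬p p)

[⌊⌋]-no : ∀ {P : Set} (P? : Dec P) → ¬ P → [ ⌊ P? ⌋ ] ≡ 0
[⌊⌋]-no (yes p) ¬p = ⊥-elim (¬p p)
[⌊⌋]-no (no _)  _  = refl

count : List ℕ → ℕ → ℕ
count xs k = ℕSum.Σ xs (λ i → [ ⌊ k ℕ.≟ i ⌋ ])

count-upTo : ∀ j k → count (upTo j) k ≡ [ ⌊ k ℕ.<? j ⌋ ]
count-upTo zero    k = refl
count-upTo (suc j) k = begin
  count (upTo (suc j)) k                        ≡⟨ cong (λ xs → count xs k) (sym (upTo-∷ʳ j)) ⟩
  count (upTo j ++ j ∷ []) k                    ≡⟨ ℕSum.Σ-++ (upTo j) (j ∷ []) (λ i → [ ⌊ k ℕ.≟ i ⌋ ]) ⟩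
  count (upTo j) k ℕ.+ count (j ∷ []) k         ≡⟨ cong (ℕ._+ count (j ∷ []) k) (count-upTo j k) ⟩
  [ ⌊ k ℕ.<? j ⌋ ] ℕ.+ ([ ⌊ k ℕ.≟ j ⌋ ] ℕ.+ 0)  ≡⟨ by-cases (ℕₚ.<-cmp k j) ⟩
  [ ⌊ k ℕ.<? suc j ⌋ ]                          ∎
  where
  open ≡-Reasoning
  evaluate : ∀ {p q r} → [ ⌊ k ℕ.<? j ⌋ ] ≡ p → [ ⌊ k ℕ.≟ j ⌋ ] ≡ q → [ ⌊ k ℕ.<? suc j ⌋ ] ≡ r →
          p ℕ.+ (q ℕ.+ 0) ≡ r → [ ⌊ k ℕ.<? j ⌋ ] ℕ.+ ([ ⌊ k ℕ.≟ j ⌋ ] ℕ.+ 0) ≡ [ ⌊ k ℕ.<? suc j ⌋ ]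
  evaluate refl refl refl eq = eq
  by-cases : Tri (k ℕ.< j) (k ≡ j) (j ℕ.< k) → [ ⌊ k ℕ.<? j ⌋ ] ℕ.+ ([ ⌊ k ℕ.≟ j ⌋ ] ℕ.+ 0) ≡ [ ⌊ k ℕ.<? suc j ⌋ ]
  by-cases (tri< k<j k≢j _) =
    evaluate ([⌊⌋]-yes (k ℕ.<? j) k<j) ([⌊⌋]-no (k ℕ.≟ j) k≢j) ([⌊⌋]-yes (k ℕ.<? suc j) (ℕₚ.m<n⇒m<1+n k<j)) refl
  by-cases (tri≈ k≮j k≡j _) =
    evaluate ([⌊⌋]-no (k ℕ.<? j) k≮j) ([⌊⌋]-yes (k ℕ.≟ j) k≡j) ([⌊⌋]-yes (k ℕ.<? suc j) (ℕₚ.≤-reflexive (cong suc k≡j))) refl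
  by-cases (tri> _ k≢j j<k) =
    evaluate ([⌊⌋]-no (k ℕ.<? j) (ℕₚ.<⇒≯ j<k)) ([⌊⌋]-no (k ℕ.≟ j) k≢j) ([⌊⌋]-no (k ℕ.<? suc j) (ℕₚ.<⇒≱ j<k ∘ ℕ.s≤s⁻¹)) refl

-- upTo (3 + Δ) reduces to 0 ∷ 1 ∷ 2 ∷ drop 3 (upTo (3 + Δ)), so the two counts differ by [ k < 3 ].
count-drop3-upTo : ∀ Δ k → k ℕ.≤ Δ → count (drop 3 (upTo (suc Δ))) k ≡ [ ⌊ 3 ℕ.≤? k ⌋ ]
count-drop3-upTo zero          zero    _ = refl
count-drop3-upTo (suc zero)    zero    _ = refl
count-drop3-upTo (suc zero)    (suc zero) _ = refl
count-drop3-upTo (suc zero)    (suc (suc _)) (s≤s ())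
count-drop3-upTo (suc (suc Δ)) zero    _ = ℕₚ.suc-injective (count-upTo (3 ℕ.+ Δ) 0)
count-drop3-upTo (suc (suc Δ)) (suc zero) _ = ℕₚ.suc-injective (count-upTo (3 ℕ.+ Δ) 1)
count-drop3-upTo (suc (suc Δ)) (suc (suc zero)) _ = ℕₚ.suc-injective (count-upTo (3 ℕ.+ Δ) 2)
count-drop3-upTo (suc (suc Δ)) k@(suc (suc (suc _))) k≤Δ =
  trans (count-upTo (3 ℕ.+ Δ) k) ([⌊⌋]-yes (k ℕ.<? 3 ℕ.+ Δ) (s≤s k≤Δ))

𝟙≥3 : ℕ → ℚ
𝟙≥3 d = ⟦ [ ⌊ 3 ℕ.≤? d ⌋ ] ⟧

[d-1][d-2]≡𝟙≥3*[d-1][d-2] : ∀ d → 1 ℕ.≤ d →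
  (⟦ d ⟧ - ⟦ 1 ⟧) * (⟦ d ⟧ - ⟦ 2 ⟧) ≡ 𝟙≥3 d * ((⟦ d ⟧ - ⟦ 1 ⟧) * (⟦ d ⟧ - ⟦ 2 ⟧))
[d-1][d-2]≡𝟙≥3*[d-1][d-2] 1                   _ = refl
[d-1][d-2]≡𝟙≥3*[d-1][d-2] 2                   _ = refl
[d-1][d-2]≡𝟙≥3*[d-1][d-2] d@(suc (suc (suc _))) _ = sym (*-identityˡ ((⟦ d ⟧ - ⟦ 1 ⟧) * (⟦ d ⟧ - ⟦ 2 ⟧)))

module _ {n : ℕ} (G : Graph n) where

  deg≤maxDeg : ∀ v → deg G v ℕ.≤ maxDeg G
  deg≤maxDeg v = ∈⇒≤max (∈-map⁺ (deg G) (∈-allFin v))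

  adjacent⇒deg≥1 : ∀ {v w} → adj G v w ≡ true → 1 ℕ.≤ deg G v
  adjacent⇒deg≥1 {v} {w} v~w =
    subst (ℕ._≤ deg G v) (cong [_] v~w) (∈⇒≤sum (∈-map⁺ (λ u → [ adj G v u ]) (∈-allFin w)))

  reach⇒deg≥1 : ∀ {v u} → Reach G v u → ¬ v ≡ u → 1 ℕ.≤ deg G v
  reach⇒deg≥1 here         v≢v = ⊥-elim (v≢v refl)
  reach⇒deg≥1 (step v~w _) _   = adjacent⇒deg≥1 v~w

  handshake : ℕSum.Σ (allFin n) (deg G) ≡ 2 ℕ.* edges G
  handshake = begin
      Σᵥ (λ i → Σᵥ (a i))
    ≡⟨ ℕSum.Σ-cong V (λ i → ℕSum.Σ-cong V (adj-by-order i)) ⟩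
      Σᵥ (λ i → Σᵥ (λ j → lt i j ℕ.* a i j ℕ.+ lt j i ℕ.* a i j))
    ≡⟨ ℕSum.Σ-cong V (λ i → ℕSum.Σ-∙ V (λ j → lt i j ℕ.* a i j) (λ j → lt j i ℕ.* a i j)) ⟩
      Σᵥ (λ i → Σᵥ (λ j → lt i j ℕ.* a i j) ℕ.+ Σᵥ (λ j → lt j i ℕ.* a i j))
    ≡⟨ ℕSum.Σ-∙ V _ _ ⟩
      edges G ℕ.+ Σᵥ (λ i → Σᵥ (λ j → lt j i ℕ.* a i j))
    ≡⟨ cong (edges G ℕ.+_) (ℕSum.Σ-swap V V (λ i j → lt j i ℕ.* a i j)) ⟩
      edges G ℕ.+ Σᵥ (λ j → Σᵥ (λ i → lt j i ℕ.* a i j))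
    ≡⟨ cong (edges G ℕ.+_) (ℕSum.Σ-cong V (λ j → ℕSum.Σ-cong V (λ i → cong (λ b → lt j i ℕ.* [ b ]) (adj-sym G i j)))) ⟩
      edges G ℕ.+ edges G
    ≡⟨ cong (edges G ℕ.+_) (sym (ℕₚ.+-identityʳ (edges G))) ⟩
      2 ℕ.* edges G
    ∎
    where
    open ≡-Reasoning
    V : List (Fin n)
    V = allFin n
    Σᵥ : (Fin n → ℕ) → ℕ
    Σᵥ = ℕSum.Σ V
    a lt : Fin n → Fin n → ℕ
    a i j = [ adj G i j ]
    lt i j = [ ⌊ toℕ i ℕ.<? toℕ j ⌋ ]
    adj-by-order : ∀ i j → a i j ≡ lt i j ℕ.* a i j ℕ.+ lt j i ℕ.* a i j
    adj-by-order i j with toℕ i ℕ.<? toℕ j | toℕ j ℕ.<? toℕ i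
    ... | yes i<j | yes j<i = ⊥-elim (ℕₚ.<-asym i<j j<i)
    ... | yes _   | no _    = sym (trans (ℕₚ.+-identityʳ _) (ℕₚ.+-identityʳ _))
    ... | no _    | yes _   = sym (ℕₚ.+-identityʳ _)
    ... | no i≮j  | no j≮i with toℕ-injective (ℕₚ.≤-antisym (ℕₚ.≮⇒≥ j≮i) (ℕₚ.≮⇒≥ i≮j))
    ...   | refl rewrite adj-irrefl G i = refl

  Σ-N-grouping : ∀ (xs : List ℕ) (g : ℕ → ℚ) →
    Σ xs (λ i → ⟦ N G i ⟧ * g i) ≡ Σ (allFin n) (λ v → ⟦ count xs (deg G v) ⟧ * g (deg G v))
  Σ-N-grouping xs g = begin
      Σ xs (λ i → ⟦ N G i ⟧ * g i)
    ≡⟨ Σ-cong xs (λ i → cong (_* g i) (⟦⟧-Σ V (λ v → [ ⌊ deg G v ℕ.≟ i ⌋ ]))) ⟩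
      Σ xs (λ i → Σ V (λ v → e v i) * g i)
    ≡⟨ Σ-cong xs (λ i → sym (Σ-*ʳ V (λ v → e v i) (g i))) ⟩
      Σ xs (λ i → Σ V (λ v → e v i * g i))
    ≡⟨ Σ-swap xs V (λ i v → e v i * g i) ⟩
      Σ V (λ v → Σ xs (λ i → e v i * g i))
    ≡⟨ Σ-cong V (λ v → Σ-cong xs (select (deg G v))) ⟩
      Σ V (λ v → Σ xs (λ i → e v i * g (deg G v)))
    ≡⟨ Σ-cong V (λ v → Σ-*ʳ xs (e v) (g (deg G v))) ⟩
      Σ V (λ v → Σ xs (e v) * g (deg G v))
    ≡⟨ Σ-cong V (λ v → cong (_* g (deg G v)) (sym (⟦⟧-Σ xs (λ i → [ ⌊ deg G v ℕ.≟ i ⌋ ])))) ⟩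
      Σ V (λ v → ⟦ count xs (deg G v) ⟧ * g (deg G v))
    ∎
    where
    open ≡-Reasoning
    V : List (Fin n)
    V = allFin n
    e : Fin n → ℕ → ℚ
    e v i = ⟦ [ ⌊ deg G v ℕ.≟ i ⌋ ] ⟧
    select : ∀ k i → ⟦ [ ⌊ k ℕ.≟ i ⌋ ] ⟧ * g i ≡ ⟦ [ ⌊ k ℕ.≟ i ⌋ ] ⟧ * g k
    select k i with k ℕ.≟ i
    ... | yes refl = refl
    ... | no _     = trans (*-zeroˡ (g i)) (sym (*-zeroˡ (g k)))

  sumFromTo3-N : ∀ (g : ℕ → ℚ) →
    sumFromTo 3 (maxDeg G) (λ i → ⟦ N G i ⟧ * g i) ≡ Σ (allFin n) (λ v → 𝟙≥3 (deg G v) * g (deg G v))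
  sumFromTo3-N g = trans (Σ-N-grouping (drop 3 (upTo (suc (maxDeg G)))) g)
    (Σ-cong (allFin n) (λ v → cong (λ c → ⟦ c ⟧ * g (deg G v))
      (count-drop3-upTo (maxDeg G) (deg G v) (deg≤maxDeg v))))

connected⇒deg≥1 : ∀ {n} (G : Graph n) → Connected G → 2 ℕ.≤ n → ∀ v → 1 ℕ.≤ deg G v
connected⇒deg≥1 {suc zero}    G connected (s≤s ()) v
connected⇒deg≥1 {suc (suc _)} G connected _ v =
  reach⇒deg≥1 G (connected v (punchIn v Fin.zero)) (punchInᵢ≢i v Fin.zero ∘ sym)

module _ {n : ℕ} .{{_ : NonZero n}} (G : Graph n) where
  private
    V : List (Fin n)
    V = allFin n
    x : ℚ
    x = (+ 1) / n
    m : ℕ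
    m = edges G

  Σ-deg : Σ V (λ v → ⟦ deg G v ⟧) ≡ ⟦ 2 ℕ.* m ⟧
  Σ-deg = trans (sym (⟦⟧-Σ V (deg G))) (cong ⟦_⟧ (handshake G))

  Σ-const-vertices : ∀ r → Σ V (λ _ → r) ≡ ⟦ n ⟧ * r
  Σ-const-vertices r = trans (Σ-const V r) (cong (λ l → ⟦ l ⟧ * r) (length-tabulate {n = n} (λ v → v)))

  avgDeg≡⟦2m⟧*1/n : avgDeg G ≡ ⟦ 2 ℕ.* m ⟧ * x
  avgDeg≡⟦2m⟧*1/n = k/n≡⟦k⟧*1/n (2 ℕ.* m) n

  Σ-deg-avgDeg : Σ V (λ v → ⟦ deg G v ⟧ - avgDeg G) ≡ 0ℚ
  Σ-deg-avgDeg = begin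
      Σ V (λ v → ⟦ deg G v ⟧ - avgDeg G)
    ≡⟨ Σ-- V (λ v → ⟦ deg G v ⟧) (λ _ → avgDeg G) ⟩
      Σ V (λ v → ⟦ deg G v ⟧) - Σ V (λ _ → avgDeg G)
    ≡⟨ cong₂ _-_ Σ-deg (Σ-const-vertices (avgDeg G)) ⟩
      ⟦ 2 ℕ.* m ⟧ - ⟦ n ⟧ * avgDeg G
    ≡⟨ cong (λ a → ⟦ 2 ℕ.* m ⟧ - ⟦ n ⟧ * a) avgDeg≡⟦2m⟧*1/n ⟩
      ⟦ 2 ℕ.* m ⟧ - ⟦ n ⟧ * (⟦ 2 ℕ.* m ⟧ * x)
    ≡⟨ ≡-modulo-inverse {⟦ n ⟧} {x} ⟦ 2 ℕ.* m ⟧ (⟦n⟧*1/n≡1 n)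
         (solve 3 (λ M N x → M :- N :* (M :* x) := con 0ℚ :+ (con 1ℚ :- N :* x) :* M) refl ⟦ 2 ℕ.* m ⟧ ⟦ n ⟧ x) ⟩
      0ℚ
    ∎
    where open ≡-Reasoning

  Σ-[d-1][d-2] : (∀ v → 1 ℕ.≤ deg G v) →
    Σ V (λ v → (⟦ deg G v ⟧ - ⟦ 1 ⟧) * (⟦ deg G v ⟧ - ⟦ 2 ⟧))
    ≡ sumFromTo 3 (maxDeg G) (λ i → ⟦ N G i ⟧ * (⟦ i ⟧ - ⟦ 1 ⟧) * (⟦ i ⟧ - ⟦ 2 ⟧))
  Σ-[d-1][d-2] deg≥1 = begin
      Σ V (λ v → w (deg G v))
    ≡⟨ Σ-cong V (λ v → [d-1][d-2]≡𝟙≥3*[d-1][d-2] (deg G v) (deg≥1 v)) ⟩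
      Σ V (λ v → 𝟙≥3 (deg G v) * w (deg G v))
    ≡⟨ sym (sumFromTo3-N G w) ⟩
      sumFromTo 3 (maxDeg G) (λ i → ⟦ N G i ⟧ * w i)
    ≡⟨ Σ-cong (drop 3 (upTo (suc (maxDeg G)))) (λ i → sym (*-assoc ⟦ N G i ⟧ (⟦ i ⟧ - ⟦ 1 ⟧) (⟦ i ⟧ - ⟦ 2 ⟧))) ⟩
      sumFromTo 3 (maxDeg G) (λ i → ⟦ N G i ⟧ * (⟦ i ⟧ - ⟦ 1 ⟧) * (⟦ i ⟧ - ⟦ 2 ⟧))
    ∎
    where
    open ≡-Reasoning
    w : ℕ → ℚ
    w i = (⟦ i ⟧ - ⟦ 1 ⟧) * (⟦ i ⟧ - ⟦ 2 ⟧)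

  Var-formula : (∀ v → 1 ℕ.≤ deg G v) →
    Var G ≡ x * sumFromTo 3 (maxDeg G) (λ i → ⟦ N G i ⟧ * (⟦ i ⟧ - ⟦ 1 ⟧) * (⟦ i ⟧ - ⟦ 2 ⟧))
            - (((+ 2) / n) * x) * ((⟦ 2 ℕ.* m ⟧ - ⟦ n ⟧) * (⟦ m ⟧ - ⟦ n ⟧))
  Var-formula deg≥1 = begin
      x * Σ V (λ v → (⟦ deg G v ⟧ - a) * (⟦ deg G v ⟧ - a))
    ≡⟨ cong (x *_) (Σ-cong V (λ v → square-expansion ⟦ deg G v ⟧ a)) ⟩
      x * Σ V (λ v → w v + ((⟦ 3 ⟧ - ⟦ 2 ⟧ * a) * ⟦ deg G v ⟧ + (a * a - ⟦ 2 ⟧)))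
    ≡⟨ cong (x *_) (trans (Σ-∙ V w _) (cong (_+_ T) (trans (Σ-∙ V _ _)
         (cong₂ _+_ (Σ-*ˡ V (λ v → ⟦ deg G v ⟧) (⟦ 3 ⟧ - ⟦ 2 ⟧ * a)) (Σ-const-vertices (a * a - ⟦ 2 ⟧)))))) ⟩
      x * (T + ((⟦ 3 ⟧ - ⟦ 2 ⟧ * a) * Σ V (λ v → ⟦ deg G v ⟧) + ⟦ n ⟧ * (a * a - ⟦ 2 ⟧)))
    ≡⟨ cong (λ s → x * (T + ((⟦ 3 ⟧ - ⟦ 2 ⟧ * a) * s + ⟦ n ⟧ * (a * a - ⟦ 2 ⟧)))) Σ-deg ⟩
      x * (T + ((⟦ 3 ⟧ - ⟦ 2 ⟧ * a) * ⟦ 2 ℕ.* m ⟧ + ⟦ n ⟧ * (a * a - ⟦ 2 ⟧)))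
    ≡⟨ cong (λ a → x * (T + ((⟦ 3 ⟧ - ⟦ 2 ⟧ * a) * ⟦ 2 ℕ.* m ⟧ + ⟦ n ⟧ * (a * a - ⟦ 2 ⟧)))) avgDeg≡⟦2m⟧*1/n ⟩
      x * (T + ((⟦ 3 ⟧ - ⟦ 2 ⟧ * (M2 * x)) * M2 + ⟦ n ⟧ * ((M2 * x) * (M2 * x) - ⟦ 2 ⟧)))
    ≡⟨ cong (λ M2 → x * (T + ((⟦ 3 ⟧ - ⟦ 2 ⟧ * (M2 * x)) * M2 + ⟦ n ⟧ * ((M2 * x) * (M2 * x) - ⟦ 2 ⟧))))
         (⟦⟧-homo-* 2 m) ⟩
      _
    ≡⟨ variance-identity T ⟦ m ⟧ ⟦ n ⟧ x (⟦n⟧*1/n≡1 n) ⟩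
      x * T - ⟦ 2 ⟧ * x * x * ((⟦ 2 ⟧ * ⟦ m ⟧ - ⟦ n ⟧) * (⟦ m ⟧ - ⟦ n ⟧))
    ≡⟨ cong₂ (λ t c → x * T - c * x * ((t - ⟦ n ⟧) * (⟦ m ⟧ - ⟦ n ⟧))) (sym (⟦⟧-homo-* 2 m)) (sym (k/n≡⟦k⟧*1/n 2 n)) ⟩
      x * T - ((+ 2) / n) * x * ((M2 - ⟦ n ⟧) * (⟦ m ⟧ - ⟦ n ⟧))
    ≡⟨ cong (λ t → x * t - ((+ 2) / n) * x * ((M2 - ⟦ n ⟧) * (⟦ m ⟧ - ⟦ n ⟧))) (Σ-[d-1][d-2] deg≥1) ⟩
      x * sumFromTo 3 (maxDeg G) (λ i → ⟦ N G i ⟧ * (⟦ i ⟧ - ⟦ 1 ⟧) * (⟦ i ⟧ - ⟦ 2 ⟧))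
        - ((+ 2) / n) * x * ((M2 - ⟦ n ⟧) * (⟦ m ⟧ - ⟦ n ⟧))
    ∎
    where
    open ≡-Reasoning
    a M2 T : ℚ
    a = avgDeg G
    M2 = ⟦ 2 ℕ.* m ⟧
    w : Fin n → ℚ
    w v = (⟦ deg G v ⟧ - ⟦ 1 ⟧) * (⟦ deg G v ⟧ - ⟦ 2 ⟧)
    T = Σ V w

  deg-avgDeg≡ : ∀ d → ⟦ d ⟧ - avgDeg G ≡ x * (⟦ d ℕ.* n ⟧ - ⟦ 2 ℕ.* m ⟧)
  deg-avgDeg≡ d = begin
      ⟦ d ⟧ - avgDeg G
    ≡⟨ cong (_-_ ⟦ d ⟧) avgDeg≡⟦2m⟧*1/n ⟩
      ⟦ d ⟧ - ⟦ 2 ℕ.* m ⟧ * x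
    ≡⟨ ≡-modulo-inverse {⟦ n ⟧} {x} ⟦ d ⟧ (⟦n⟧*1/n≡1 n)
         (solve 4 (λ D N M x → D :- M :* x := x :* (D :* N :- M) :+ (con 1ℚ :- N :* x) :* D) refl ⟦ d ⟧ ⟦ n ⟧ ⟦ 2 ℕ.* m ⟧ x) ⟩
      x * (⟦ d ⟧ * ⟦ n ⟧ - ⟦ 2 ℕ.* m ⟧)
    ≡⟨ cong (λ t → x * (t - ⟦ 2 ℕ.* m ⟧)) (sym (⟦⟧-homo-* d n)) ⟩
      x * (⟦ d ℕ.* n ⟧ - ⟦ 2 ℕ.* m ⟧)
    ∎
    where open ≡-Reasoning

  module _ (n≤m : n ℕ.≤ m) (2m≤3n : 2 ℕ.* m ℕ.≤ 3 ℕ.* n) where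

    avgDeg≤deg : ∀ {d} → 3 ℕ.≤ d → avgDeg G ≤ ⟦ d ⟧
    avgDeg≤deg {d} 3≤d = begin
      avgDeg G             ≡⟨ avgDeg≡⟦2m⟧*1/n ⟩
      ⟦ 2 ℕ.* m ⟧ * x      ≤⟨ ⟦⟧*1/n-mono-≤ n (ℕₚ.≤-trans 2m≤3n (ℕₚ.*-monoˡ-≤ n 3≤d)) ⟩
      ⟦ d ℕ.* n ⟧ * x      ≡⟨ sym (⟦k⟧≡⟦k*n⟧*1/n d n) ⟩
      ⟦ d ⟧                ∎
      where open ≤-Reasoning

    deg≤avgDeg : ∀ {d} → d ℕ.≤ 2 → ⟦ d ⟧ ≤ avgDeg G
    deg≤avgDeg {d} d≤2 = begin
      ⟦ d ⟧                ≡⟨ ⟦k⟧≡⟦k*n⟧*1/n d n ⟩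
      ⟦ d ℕ.* n ⟧ * x      ≤⟨ ⟦⟧*1/n-mono-≤ n (ℕₚ.≤-trans (ℕₚ.*-monoˡ-≤ n d≤2) (ℕₚ.*-monoʳ-≤ 2 n≤m)) ⟩
      ⟦ 2 ℕ.* m ⟧ * x      ≡⟨ sym avgDeg≡⟦2m⟧*1/n ⟩
      avgDeg G             ∎
      where open ≤-Reasoning

    ∣deg-avgDeg∣ : ∀ d → ∣ ⟦ d ⟧ - avgDeg G ∣ ≡ ⟦ 2 ⟧ * (𝟙≥3 d * (⟦ d ⟧ - avgDeg G)) - (⟦ d ⟧ - avgDeg G)
    ∣deg-avgDeg∣ d = ∣p-q∣-by-sign (3 ℕ.≤? d) avgDeg≤deg (deg≤avgDeg ∘ ℕ.s≤s⁻¹ ∘ ℕₚ.≰⇒>)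

    S-formula : S G ≡ ((+ 2) / n) * sumFromTo 3 (maxDeg G) (λ i → ⟦ N G i ⟧ * (⟦ i ℕ.* n ⟧ - ⟦ 2 ℕ.* m ⟧))
    S-formula = begin
        Σ V (λ v → ∣ y (deg G v) ∣)
      ≡⟨ Σ-cong V (λ v → ∣deg-avgDeg∣ (deg G v)) ⟩
        Σ V (λ v → ⟦ 2 ⟧ * (𝟙≥3 (deg G v) * y (deg G v)) - y (deg G v))
      ≡⟨ Σ-- V (λ v → ⟦ 2 ⟧ * (𝟙≥3 (deg G v) * y (deg G v))) (λ v → y (deg G v)) ⟩
        Σ V (λ v → ⟦ 2 ⟧ * (𝟙≥3 (deg G v) * y (deg G v))) - Σ V (λ v → y (deg G v))
      ≡⟨ cong₂ _-_ (Σ-*ˡ V (λ v → 𝟙≥3 (deg G v) * y (deg G v)) ⟦ 2 ⟧) Σ-deg-avgDeg ⟩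
        ⟦ 2 ⟧ * Σ V (λ v → 𝟙≥3 (deg G v) * y (deg G v)) - 0ℚ
      ≡⟨ +-identityʳ (⟦ 2 ⟧ * Σ V (λ v → 𝟙≥3 (deg G v) * y (deg G v))) ⟩
        ⟦ 2 ⟧ * Σ V (λ v → 𝟙≥3 (deg G v) * y (deg G v))
      ≡⟨ cong (⟦ 2 ⟧ *_) (sym (sumFromTo3-N G y)) ⟩
        ⟦ 2 ⟧ * Σ R (λ i → ⟦ N G i ⟧ * y i)
      ≡⟨ cong (⟦ 2 ⟧ *_) (Σ-cong R (λ i → cong (⟦ N G i ⟧ *_) (deg-avgDeg≡ i))) ⟩
        ⟦ 2 ⟧ * Σ R (λ i → ⟦ N G i ⟧ * (x * z i))
      ≡⟨ cong (⟦ 2 ⟧ *_) (trans (Σ-cong R (λ i → x∙yz≈y∙xz ⟦ N G i ⟧ x (z i))) (Σ-*ˡ R (λ i → ⟦ N G i ⟧ * z i) x)) ⟩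
        ⟦ 2 ⟧ * (x * Σ R (λ i → ⟦ N G i ⟧ * z i))
      ≡⟨ sym (*-assoc ⟦ 2 ⟧ x (Σ R (λ i → ⟦ N G i ⟧ * z i))) ⟩
        (⟦ 2 ⟧ * x) * Σ R (λ i → ⟦ N G i ⟧ * z i)
      ≡⟨ cong (_* Σ R (λ i → ⟦ N G i ⟧ * z i)) (sym (k/n≡⟦k⟧*1/n 2 n)) ⟩
        ((+ 2) / n) * Σ R (λ i → ⟦ N G i ⟧ * z i)
      ∎
      where
      open ≡-Reasoning
      R : List ℕ
      R = drop 3 (upTo (suc (maxDeg G)))
      y z : ℕ → ℚ
      y d = ⟦ d ⟧ - avgDeg G
      z i = ⟦ i ℕ.* n ⟧ - ⟦ 2 ℕ.* m ⟧

cyclomatic≥1⇒n≤m : ∀ {n} (G : Graph n) → ⟦ 1 ⟧ ≤ cyclomatic G → n ℕ.≤ edges G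
cyclomatic≥1⇒n≤m {n} G 1≤c = ⟦⟧-cancel-≤ (shift-≤ (⟦ n ⟧ - ⟦ 1 ⟧) 1≤c
  (solve 2 (λ N o → o :+ (N :- o) := N) refl ⟦ n ⟧ ⟦ 1 ⟧)
  (solve 3 (λ M N o → (M :- N :+ o) :+ (N :- o) := M) refl ⟦ edges G ⟧ ⟦ n ⟧ ⟦ 1 ⟧))

cyclomatic≤⇒2m≤3n : ∀ {n} (G : Graph n) → cyclomatic G ≤ (+ (n ℕ.+ 2)) / 2 → 2 ℕ.* edges G ℕ.≤ 3 ℕ.* n
cyclomatic≤⇒2m≤3n {n} G c≤ = ⟦⟧-cancel-≤ (shift-≤ (⟦ 2 ⟧ * ⟦ n ⟧ - ⟦ 2 ⟧)
  (*-monoˡ-≤-nonNeg ⟦ 2 ⟧ {{normalize-nonNeg 2 1}} c≤)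
  (trans (solve 3 (λ t M N → t :* (M :- N :+ con ⟦ 1 ⟧) :+ (t :* N :- t) := t :* M) refl ⟦ 2 ⟧ ⟦ edges G ⟧ ⟦ n ⟧)
         (sym (⟦⟧-homo-* 2 (edges G))))
  (begin
    ⟦ 2 ⟧ * ((+ (n ℕ.+ 2)) / 2) + (⟦ 2 ⟧ * ⟦ n ⟧ - ⟦ 2 ⟧)  ≡⟨ cong (_+ (⟦ 2 ⟧ * ⟦ n ⟧ - ⟦ 2 ⟧)) (⟦n⟧*k/n≡⟦k⟧ 2 (n ℕ.+ 2)) ⟩
    ⟦ n ℕ.+ 2 ⟧ + (⟦ 2 ⟧ * ⟦ n ⟧ - ⟦ 2 ⟧)                  ≡⟨ cong (_+ (⟦ 2 ⟧ * ⟦ n ⟧ - ⟦ 2 ⟧)) (⟦⟧-homo-+ n 2) ⟩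
    ⟦ n ⟧ + ⟦ 2 ⟧ + (⟦ 2 ⟧ * ⟦ n ⟧ - ⟦ 2 ⟧)                ≡⟨ solve 1 (λ N → N :+ con ⟦ 2 ⟧ :+ (con ⟦ 2 ⟧ :* N :- con ⟦ 2 ⟧) := con ⟦ 3 ⟧ :* N) refl ⟦ n ⟧ ⟩
    ⟦ 3 ⟧ * ⟦ n ⟧                                           ≡⟨ sym (⟦⟧-homo-* 3 n) ⟩
    ⟦ 3 ℕ.* n ⟧                                             ∎))
  where open ≡-Reasoning

-- On one vertex the pair sum defining edges G has no term with i < j, so it computes to 0.
n≤edges⇒2≤n : ∀ {n} .{{_ : NonZero n}} (G : Graph n) → n ℕ.≤ edges G → 2 ℕ.≤ n
n≤edges⇒2≤n {suc zero}    G ()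
n≤edges⇒2≤n {suc (suc _)} G _ = s≤s (s≤s z≤n)

theorem27 : (n : ℕ) .{{_ : NonZero n}} (G : Graph n) → Connected G →
    ⟦ 1 ⟧ ≤ cyclomatic G → cyclomatic G ≤ (+ (n ℕ.+ 2)) / 2 →
    (S G ≡ ((+ 2) / n) * sumFromTo 3 (maxDeg G)
              (λ i → ⟦ N G i ⟧ * (⟦ i ℕ.* n ⟧ - ⟦ 2 ℕ.* edges G ⟧)))
    × (Var G ≡ ((+ 1) / n) * sumFromTo 3 (maxDeg G)
                 (λ i → ⟦ N G i ⟧ * (⟦ i ⟧ - ⟦ 1 ⟧) * (⟦ i ⟧ - ⟦ 2 ⟧))
               - (((+ 2) / n) * ((+ 1) / n)) * ((⟦ 2 ℕ.* edges G ⟧ - ⟦ n ⟧) * (⟦ edges G ⟧ - ⟦ n ⟧)))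
theorem27 n G connected 1≤c c≤[n+2]/2 =
  S-formula G n≤m (cyclomatic≤⇒2m≤3n G c≤[n+2]/2) ,
  Var-formula G (connected⇒deg≥1 G connected (n≤edges⇒2≤n G n≤m))
  where
  n≤m : n ℕ.≤ edges G
  n≤m = cyclomatic≥1⇒n≤m G 1≤c
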